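{- Let $\mathcal{AP}$ be the set of all anti-palindromic compositions (of all weights $n\ge 0$). Then $$\sum_{\sigma\in \mathcal{AP}}x^{|\sigma|}y^{\mathrm{parts}(\sigma)}=\frac{1 - x - x^2 + x^3 + x y - x^3 y}{1 - x - x^2 + x^3 - 2 x^3 y^2}.$$
   Context: A composition of $n\ge0$ is a finite sequence $\sigma=(\sigma_1,\dots,\sigma_\ell)$ of positive integers summing to $n$; $|\sigma|=n$ is its weight and $\mathrm{parts}(\sigma)=\ell$ (the empty composition is the composition of $0$ with $0$ parts). A composition $(\sigma_1,\dots,\sigma_\ell)$ is anti-palindromic if $\sigma_i\neq\sigma_{\ell+1-i}$ for all $i\in\{1,\dots,\ell\}$ with $i\neq(\ell+1)/2$. -}

module Defs where

open import Data.Nat as ℕ using (ℕ; zero; suc; _∸_; _<_)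
open import Data.Nat.Properties using (_≟_)
open import Data.Integer as ℤ using (ℤ; +_; -_)
open import Data.List using (List; []; _∷_; length; lookup; map; upTo; foldr)
open import Data.Nat.ListAction using (sum)
open import Data.List.Relation.Unary.All using (All)
open import Data.List.Relation.Unary.Unique.Propositional using (Unique)
open import Data.List.Membership.Propositional using (_∈_)
open import Data.Fin using (Fin; opposite)
open import Data.Product using (_×_; _,_; ∃)
open import Function.Bundles using (_⇔_)
open import Relation.Binary.PropositionalEquality using (_≡_; _≢_)
open import Relation.Nullary.Decidable using (does)
open import Data.Bool using (_∧_; if_then_else_)

IsComposition : ℕ → List ℕ → Set
IsComposition n σ = All (λ p → 0 < p) σ × sum σ ≡ n

-- Anti-palindromic: σ_i ≠ σ_{ℓ+1-i} for every position i that is not the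
-- middle one.  With 0-based Fin indices, the mirror of i is `opposite i`,
-- and "i ≠ (ℓ+1)/2" is exactly "i ≢ opposite i".
AntiPalindromic : List ℕ → Set
AntiPalindromic σ =
  (i : Fin (length σ)) → i ≢ opposite i → lookup σ i ≢ lookup σ (opposite i)

APComp : ℕ → ℕ → List ℕ → Set
APComp n k σ = IsComposition n σ × length σ ≡ k × AntiPalindromic σ

IsAPCount : ℕ → ℕ → ℕ → Set
IsAPCount n k c =
  ∃ λ (L : List (List ℕ)) →
    Unique L × (∀ σ → (σ ∈ L) ⇔ APComp n k σ) × length L ≡ c

-- Formal power series in x, y with integer coefficients:
-- s n k is the coefficient of x^n y^k.
Series : Set
Series = ℕ → ℕ → ℤ

sumℤ : List ℤ → ℤ
sumℤ = foldr ℤ._+_ (+ 0)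

_⊛_ : Series → Series → Series
(f ⊛ g) n k =
  sumℤ (map (λ i → sumℤ (map (λ j → f i j ℤ.* g (n ∸ i) (k ∸ j)) (upTo (suc k))))
            (upTo (suc n)))

-- A polynomial given as a list of monomials (c , a , b) meaning c x^a y^b.
Monomial : Set
Monomial = ℤ × ℕ × ℕ

poly : List Monomial → Series
poly ms n k =
  sumℤ (map (λ { (c , a , b) → if does (a ≟ n) ∧ does (b ≟ k) then c else + 0 }) ms)

numerator : Series
numerator = poly ( (+ 1 , 0 , 0) ∷ (- + 1 , 1 , 0) ∷ (- + 1 , 2 , 0) ∷ (+ 1 , 3 , 0)
                 ∷ (+ 1 , 1 , 1) ∷ (- + 1 , 3 , 1) ∷ [])

denominator : Series
denominator = poly ( (+ 1 , 0 , 0) ∷ (- + 1 , 1 , 0) ∷ (- + 1 , 2 , 0) ∷ (+ 1 , 3 , 0)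
                   ∷ (- + 2 , 3 , 2) ∷ [])

{-# OPTIONS --safe #-}
module Submission where

-- An anti-palindromic composition with at least two parts is a pair of distinct outer parts
-- (a, b) around a shorter anti-palindromic composition.  Either a, b ≥ 2, and lowering both by 1
-- gives such a composition of weight two less, or {a, b} = {1, c + 2}.  With c(n,k) the number of
-- anti-palindromic compositions of weight n with k parts and h(n,k) = Σ_{m<n} c(m,k) the number
-- of choices (c, inner composition) of the second kind in weight n + 2, this gives
--   c(n+2, k+2) = c(n, k+2) + 2 h(n, k)   and   h(n+1, k) = h(n, k) + c(n, k),
-- so c(n+3,k+2) − c(n+2,k+2) − c(n+1,k+2) + c(n,k+2) − 2 c(n,k) = 0: the denominator kills every
-- coefficient with n ≥ 3 and k ≥ 2; those with k ≤ 1 or n ≤ 2 are computed directly.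

open import Defs
open import Data.Nat using (ℕ)
open import Data.Integer using (+_)
open import Relation.Binary.PropositionalEquality using (_≡_)

open import Data.Bool using (Bool; true; false; _∧_; if_then_else_)
open import Data.Empty using (⊥-elim)
open import Data.Fin using (Fin; toℕ; fromℕ<; opposite)
open import Data.Fin.Properties using (toℕ-fromℕ<; opposite-prop; toℕ<n; toℕ-injective)
open import Data.Integer using (ℤ; -_)
import Data.Integer.Properties as ℤ
open import Data.Integer.Tactic.RingSolver using (solve-∀)
open import Data.List
  using (List; []; _∷_; _++_; _∷ʳ_; length; lookup; map; upTo; initLast; _∷ʳ′_)
open import Data.List.Properties
  using (length-++; length-map; map-cong; applyUpTo-∷ʳ; ∷-injective; ∷ʳ-injective)
open import Data.List.Membership.Propositional using (_∈_)
open import Data.List.Membership.Propositional.Properties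
  using (∈-map⁺; ∈-map⁻; ∈-++⁺ˡ; ∈-++⁺ʳ; ∈-++⁻)
open import Data.List.Membership.Propositional.Properties.WithK using (unique∧set⇒bag)
open import Data.List.Relation.Binary.BagAndSetEquality using (∼bag⇒↭)
open import Data.List.Relation.Binary.Disjoint.Propositional using (Disjoint)
open import Data.List.Relation.Binary.Permutation.Propositional.Properties using (↭-length)
open import Data.List.Relation.Unary.All as All using (All; []; _∷_)
import Data.List.Relation.Unary.All.Properties as All
open import Data.List.Relation.Unary.Any using (here)
open import Data.List.Relation.Unary.Unique.Propositional using (Unique; []; _∷_)
import Data.List.Relation.Unary.Unique.Propositional.Properties as Unique
open import Data.Maybe using (Maybe; just; nothing)
open import Data.Maybe.Properties using (just-injective)
open import Data.Nat as ℕ using (suc; zero; _∸_; _<_; s≤s; z<s)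
open import Data.Nat.ListAction using (sum)
open import Data.Nat.ListAction.Properties using (sum-++)
open import Data.Nat.Properties
  using (_≟_; _≤?_; <-cmp; +-suc; +-comm; +-identityʳ; suc-injective; m≤m+n; m≤n+m;
         m≤n⇒m≤1+n; 1+n≰n; <⇒≢; <⇒≱; ≤-refl; m+n∸m≡n; m+[n∸m]≡n; m+n≡0⇒n≡0)
open import Data.Product using (_×_; _,_; proj₁; proj₂; ∃; map₁)
open import Data.Sum using ([_,_]′)
open import Data.Unit using (⊤; tt)
open import Function using (_∘_; id)
open import Function.Bundles using (_⇔_; mk⇔; module Equivalence)
open Equivalence using (to; from)
open import Function.Properties.Equivalence using () renaming (sym to ⇔-sym; trans to ⇔-trans)
open import Relation.Binary.Definitions using (Tri; tri<; tri≈; tri>)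
open import Relation.Binary.PropositionalEquality
  using (_≢_; refl; sym; trans; cong; cong₂; module ≡-Reasoning)
open import Relation.Nullary.Decidable using (does; dec-true; dec-false)

private
  variable
    A B C : Set
    k n : ℕ

module Coefficients where
  open import Data.Integer using (_+_; _*_)

  sumℤ-map-zero : (f : A → ℤ) (xs : List A) → (∀ x → f x ≡ + 0) → sumℤ (map f xs) ≡ + 0
  sumℤ-map-zero f []       f≡0 = refl
  sumℤ-map-zero f (x ∷ xs) f≡0 = cong₂ _+_ (f≡0 x) (sumℤ-map-zero f xs f≡0)

  sumℤ-map-+ : (f g : A → ℤ) (xs : List A) →
    sumℤ (map (λ x → f x + g x) xs) ≡ sumℤ (map f xs) + sumℤ (map g xs)
  sumℤ-map-+ f g []       = refl
  sumℤ-map-+ f g (x ∷ xs) = begin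
    (f x + g x) + sumℤ (map (λ x → f x + g x) xs)
      ≡⟨ cong (λ z → (f x + g x) + z) (sumℤ-map-+ f g xs) ⟩
    (f x + g x) + (sumℤ (map f xs) + sumℤ (map g xs))
      ≡⟨ interchange (f x) (g x) (sumℤ (map f xs)) (sumℤ (map g xs)) ⟩
    (f x + sumℤ (map f xs)) + (g x + sumℤ (map g xs)) ∎
    where
    open ≡-Reasoning
    interchange : ∀ a b c d → (a + b) + (c + d) ≡ (a + c) + (b + d)
    interchange = solve-∀

  sumℤ-map-∷ʳ : (f : A → ℤ) (xs : List A) (x : A) →
    sumℤ (map f (xs ∷ʳ x)) ≡ sumℤ (map f xs) + f x
  sumℤ-map-∷ʳ f []       x = trans (ℤ.+-identityʳ (f x)) (sym (ℤ.+-identityˡ (f x)))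
  sumℤ-map-∷ʳ f (y ∷ xs) x =
    trans (cong (λ z → f y + z) (sumℤ-map-∷ʳ f xs x)) (sym (ℤ.+-assoc (f y) (sumℤ (map f xs)) (f x)))

  sumℤ-map-guarded : (d : Bool) (e : A → Bool) (c : ℤ) (g : A → ℤ) (xs : List A) →
    sumℤ (map (λ x → (if d ∧ e x then c else + 0) * g x) xs) ≡
    (if d then sumℤ (map (λ x → if e x then c * g x else + 0) xs) else + 0)
  sumℤ-map-guarded true  e c g xs = cong sumℤ (map-cong guard-* xs)
    where
    guard-* : ∀ x → (if e x then c else + 0) * g x ≡ (if e x then c * g x else + 0)
    guard-* x with e x
    ... | true  = refl
    ... | false = ℤ.*-zeroˡ (g x)
  sumℤ-map-guarded false e c g xs = sumℤ-map-zero _ xs (ℤ.*-zeroˡ ∘ g)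

  sumℤ-indicator : (g : ℕ → ℤ) (b m : ℕ) →
    sumℤ (map (λ j → if does (b ≟ j) then g j else + 0) (upTo (suc m))) ≡
    (if does (b ≤? m) then g b else + 0)
  sumℤ-indicator g zero    zero    = ℤ.+-identityʳ (g 0)
  sumℤ-indicator g (suc b) zero    = refl
  sumℤ-indicator g b       (suc m) = begin
    sumℤ (map δ (upTo (suc (suc m))))
      ≡⟨ cong (sumℤ ∘ map δ) (sym (applyUpTo-∷ʳ id (suc m))) ⟩
    sumℤ (map δ (upTo (suc m) ∷ʳ suc m))
      ≡⟨ sumℤ-map-∷ʳ δ (upTo (suc m)) (suc m) ⟩
    sumℤ (map δ (upTo (suc m))) + δ (suc m)
      ≡⟨ cong (λ z → z + δ (suc m)) (sumℤ-indicator g b m) ⟩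
    (if does (b ≤? m) then g b else + 0) + δ (suc m)
      ≡⟨ step (<-cmp b (suc m)) ⟩
    (if does (b ≤? suc m) then g b else + 0) ∎
    where
    open ≡-Reasoning
    δ : ℕ → ℤ
    δ j = if does (b ≟ j) then g j else + 0
    step : Tri (b < suc m) (b ≡ suc m) (suc m < b) →
         (if does (b ≤? m) then g b else + 0) + δ (suc m) ≡ (if does (b ≤? suc m) then g b else + 0)
    step (tri< (s≤s b≤m) b≢1+m _)
      rewrite dec-true (b ≤? m) b≤m | dec-false (b ≟ suc m) b≢1+m
            | dec-true (b ≤? suc m) (m≤n⇒m≤1+n b≤m)
      = ℤ.+-identityʳ (g b)
    step (tri≈ _ refl _)
      rewrite dec-false (suc m ≤? m) 1+n≰n | dec-true (suc m ≟ suc m) refl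
            | dec-true (suc m ≤? suc m) ≤-refl
      = ℤ.+-identityˡ (g (suc m))
    step (tri> _ b≢1+m 1+m<b)
      rewrite dec-false (b ≤? m) (<⇒≱ 1+m<b ∘ m≤n⇒m≤1+n) | dec-false (b ≟ suc m) b≢1+m
            | dec-false (b ≤? suc m) (<⇒≱ 1+m<b)
      = refl

  monomial : Monomial → Series
  monomial (c , a , b) i j = if does (a ≟ i) ∧ does (b ≟ j) then c else + 0

  _·ₘ_ : Monomial → Series → Series
  ((c , a , b) ·ₘ F) n k =
    if does (a ≤? n) then (if does (b ≤? k) then c * F (n ∸ a) (k ∸ b) else + 0) else + 0

  ⊛-congʳ : ∀ f {F G : Series} → (∀ n k → F n k ≡ G n k) → ∀ n k → (f ⊛ F) n k ≡ (f ⊛ G) n k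
  ⊛-congʳ f F≗G n k = cong sumℤ (map-cong (λ i → cong sumℤ (map-cong (λ j →
    cong (λ z → f i j * z) (F≗G (n ∸ i) (k ∸ j))) (upTo (suc k)))) (upTo (suc n)))

  ⊛-zeroˡ : ∀ F n k → ((λ _ _ → + 0) ⊛ F) n k ≡ + 0
  ⊛-zeroˡ F n k = sumℤ-map-zero _ (upTo (suc n)) (λ i →
    sumℤ-map-zero (λ j → + 0 * F (n ∸ i) (k ∸ j)) (upTo (suc k)) (λ j →
      ℤ.*-zeroˡ (F (n ∸ i) (k ∸ j))))

  ⊛-distribʳ-+ : ∀ f g F n k → ((λ i j → f i j + g i j) ⊛ F) n k ≡ (f ⊛ F) n k + (g ⊛ F) n k
  ⊛-distribʳ-+ f g F n k =
    trans (cong sumℤ (map-cong row-+ (upTo (suc n)))) (sumℤ-map-+ (row f) (row g) (upTo (suc n)))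
    where
    row : Series → ℕ → ℤ
    row h i = sumℤ (map (λ j → h i j * F (n ∸ i) (k ∸ j)) (upTo (suc k)))
    row-+ : ∀ i → row (λ i j → f i j + g i j) i ≡ row f i + row g i
    row-+ i = trans
      (cong sumℤ (map-cong (λ j → ℤ.*-distribʳ-+ (F (n ∸ i) (k ∸ j)) (f i j) (g i j)) (upTo (suc k))))
      (sumℤ-map-+ (λ j → f i j * F (n ∸ i) (k ∸ j)) (λ j → g i j * F (n ∸ i) (k ∸ j)) (upTo (suc k)))

  monomial-⊛ : ∀ m F n k → (monomial m ⊛ F) n k ≡ (m ·ₘ F) n k
  monomial-⊛ (c , a , b) F n k = begin
    (monomial (c , a , b) ⊛ F) n k
      ≡⟨ cong sumℤ (map-cong (λ i → sumℤ-map-guarded (does (a ≟ i)) (λ j → does (b ≟ j)) c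
                                      (λ j → F (n ∸ i) (k ∸ j)) (upTo (suc k))) (upTo (suc n))) ⟩
    sumℤ (map (λ i → if does (a ≟ i)
                       then sumℤ (map (λ j → if does (b ≟ j) then c * F (n ∸ i) (k ∸ j) else + 0)
                                      (upTo (suc k)))
                       else + 0) (upTo (suc n)))
      ≡⟨ cong sumℤ (map-cong (λ i → cong (λ z → if does (a ≟ i) then z else + 0)
                                      (sumℤ-indicator (λ j → c * F (n ∸ i) (k ∸ j)) b k)) (upTo (suc n))) ⟩
    sumℤ (map (λ i → if does (a ≟ i)
                       then (if does (b ≤? k) then c * F (n ∸ i) (k ∸ b) else + 0)
                       else + 0) (upTo (suc n)))
      ≡⟨ sumℤ-indicator (λ i → if does (b ≤? k) then c * F (n ∸ i) (k ∸ b) else + 0) a n ⟩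
    ((c , a , b) ·ₘ F) n k ∎
    where open ≡-Reasoning

  _·ₚ_ : List Monomial → Series → Series
  (ms ·ₚ F) n k = sumℤ (map (λ m → (m ·ₘ F) n k) ms)

  poly-⊛ : ∀ ms F n k → (poly ms ⊛ F) n k ≡ (ms ·ₚ F) n k
  poly-⊛ []       F n k = ⊛-zeroˡ F n k
  poly-⊛ (m@(_ , _ , _) ∷ ms) F n k =
    trans (⊛-distribʳ-+ (monomial m) (poly ms) F n k)
          (cong₂ _+_ (monomial-⊛ m F n k) (poly-⊛ ms F n k))

  denominator-annihilates : (c c′ h : ℕ → ℕ) →
    (∀ m → c (suc (suc m)) ≡ c m ℕ.+ (h m ℕ.+ h m)) →
    (∀ m → h (suc m) ≡ h m ℕ.+ c′ m) → ∀ n →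
    + 1 * + c (suc (suc (suc n))) + (- + 1 * + c (suc (suc n)) + (- + 1 * + c (suc n)
      + (+ 1 * + c n + (- + 2 * + c′ n + + 0))))
    ≡ + 0
  denominator-annihilates c c′ h c-step h-step n
    rewrite c-step (suc n) | c-step n | h-step n = identity (+ c n) (+ c (suc n)) (+ h n) (+ c′ n)
    where
    identity : ∀ c₀ c₁ h₀ d →
      + 1 * (c₁ + ((h₀ + d) + (h₀ + d))) + (- + 1 * (c₀ + (h₀ + h₀))
        + (- + 1 * c₁ + (+ 1 * c₀ + (- + 2 * d + + 0))))
      ≡ + 0
    identity = solve-∀

open Coefficients
open import Data.Nat using (_+_)

map-disjoint : {f : A → C} {g : B → C} {xs : List A} {ys : List B} →
  (∀ x y → f x ≢ g y) → Disjoint (map f xs) (map g ys)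
map-disjoint {f = f} {g} f≢g (v∈fxs , v∈gys) with ∈-map⁻ f v∈fxs | ∈-map⁻ g v∈gys
... | x , _ , refl | y , _ , fx≡gy = f≢g x y fx≡gy

disjoint-++⁺ʳ : {xs ys zs : List A} → Disjoint xs ys → Disjoint xs zs → Disjoint xs (ys ++ zs)
disjoint-++⁺ʳ {ys = ys} xs#ys xs#zs (v∈xs , v∈ys++zs) =
  [ (λ v∈ys → xs#ys (v∈xs , v∈ys)) , (λ v∈zs → xs#zs (v∈xs , v∈zs)) ]′ (∈-++⁻ ys v∈ys++zs)

unique∧set⇒length≡ : {xs ys : List A} → Unique xs → Unique ys →
  (∀ x → x ∈ xs ⇔ x ∈ ys) → length xs ≡ length ys
unique∧set⇒length≡ xs! ys! xs⇔ys = ↭-length (∼bag⇒↭ (unique∧set⇒bag xs! ys! (λ {x} → xs⇔ys x)))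

_‼_ : List A → ℕ → Maybe A
[]       ‼ _     = nothing
(x ∷ xs) ‼ zero  = just x
(x ∷ xs) ‼ suc i = xs ‼ i

‼-lookup : (xs : List A) (i : Fin (length xs)) → xs ‼ toℕ i ≡ just (lookup xs i)
‼-lookup (x ∷ xs) Fin.zero    = refl
‼-lookup (x ∷ xs) (Fin.suc i) = ‼-lookup xs i

‼-∷ʳ-< : (xs : List A) {y : A} {i : ℕ} → i < length xs → (xs ∷ʳ y) ‼ i ≡ xs ‼ i
‼-∷ʳ-< (x ∷ xs) {i = zero}  _         = refl
‼-∷ʳ-< (x ∷ xs) {i = suc i} (s≤s i<n) = ‼-∷ʳ-< xs i<n

‼-∷ʳ-length : (xs : List A) (y : A) → (xs ∷ʳ y) ‼ length xs ≡ just y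
‼-∷ʳ-length []       y = refl
‼-∷ʳ-length (x ∷ xs) y = ‼-∷ʳ-length xs y

length-∷ʳ : (xs : List A) (y : A) → length (xs ∷ʳ y) ≡ suc (length xs)
length-∷ʳ xs y = trans (length-++ xs) (+-comm (length xs) 1)

mirror-bounds : ∀ {i j ℓ} → suc (i + j) ≡ ℓ → i < ℓ × j < ℓ
mirror-bounds {i} {j} refl = s≤s (m≤m+n i j) , s≤s (m≤n+m j i)

-- AntiPalindromic with plain indices: Fin (length (xs ∷ʳ b)) does not compute.
MirrorDistinct : List A → Set
MirrorDistinct xs = ∀ i j → suc (i + j) ≡ length xs → i < j → xs ‼ i ≢ xs ‼ j

antiPalindromic⇔mirrorDistinct : (σ : List ℕ) → AntiPalindromic σ ⇔ MirrorDistinct σ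
antiPalindromic⇔mirrorDistinct σ = mk⇔ toMirror fromMirror
  where
  mirror-sum : (f : Fin (length σ)) → suc (toℕ f + toℕ (opposite f)) ≡ length σ
  mirror-sum f = trans (cong (λ j → suc (toℕ f + j)) (opposite-prop f)) (m+[n∸m]≡n (toℕ<n f))

  toMirror : AntiPalindromic σ → MirrorDistinct σ
  toMirror ap i j ij≡ℓ i<j σi≡σj =
    ap f (λ f≡f′ → <⇒≢ i<j (trans (sym toℕf≡i) (trans (cong toℕ f≡f′) toℕf′≡j)))
    (just-injective (begin
      just (lookup σ f)            ≡⟨ sym (‼-lookup σ f) ⟩
      σ ‼ toℕ f                    ≡⟨ cong (σ ‼_) toℕf≡i ⟩
      σ ‼ i                        ≡⟨ σi≡σj ⟩
      σ ‼ j                        ≡⟨ cong (σ ‼_) (sym toℕf′≡j) ⟩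
      σ ‼ toℕ (opposite f)         ≡⟨ ‼-lookup σ (opposite f) ⟩
      just (lookup σ (opposite f)) ∎))
    where
    open ≡-Reasoning
    f : Fin (length σ)
    f = fromℕ< (mirror-bounds ij≡ℓ .proj₁)
    toℕf≡i : toℕ f ≡ i
    toℕf≡i = toℕ-fromℕ< _
    toℕf′≡j : toℕ (opposite f) ≡ j
    toℕf′≡j = begin
      toℕ (opposite f)        ≡⟨ opposite-prop f ⟩
      length σ ∸ suc (toℕ f)  ≡⟨ cong₂ (λ ℓ m → ℓ ∸ suc m) (sym ij≡ℓ) toℕf≡i ⟩
      suc i + j ∸ suc i       ≡⟨ m+n∸m≡n (suc i) j ⟩
      j                       ∎

  mirror-‼ : (f : Fin (length σ)) →
    lookup σ f ≡ lookup σ (opposite f) → σ ‼ toℕ f ≡ σ ‼ toℕ (opposite f)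
  mirror-‼ f eq = trans (‼-lookup σ f) (trans (cong just eq) (sym (‼-lookup σ (opposite f))))

  fromMirror : MirrorDistinct σ → AntiPalindromic σ
  fromMirror md f f≢f′ eq with <-cmp (toℕ f) (toℕ (opposite f))
  ... | tri< i<j _ _ = md _ _ (mirror-sum f) i<j (mirror-‼ f eq)
  ... | tri≈ _ i≡j _ = f≢f′ (toℕ-injective i≡j)
  ... | tri> _ _ j<i =
    md _ _ (trans (cong suc (+-comm (toℕ (opposite f)) (toℕ f))) (mirror-sum f)) j<i (sym (mirror-‼ f eq))

length-wrap : (a : A) (xs : List A) (b : A) → length (a ∷ (xs ∷ʳ b)) ≡ 2 + length xs
length-wrap a xs b = cong suc (length-∷ʳ xs b)

mirrorDistinct-wrap⁺ : {a b : A} {xs : List A} →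
  a ≢ b → MirrorDistinct xs → MirrorDistinct (a ∷ (xs ∷ʳ b))
mirrorDistinct-wrap⁺ {a = a} {b} {xs} a≢b md zero (suc j) e z<s eq =
  a≢b (just-injective (trans eq (trans (cong ((xs ∷ʳ b) ‼_) j≡ℓ) (‼-∷ʳ-length xs b))))
  where
  j≡ℓ : j ≡ length xs
  j≡ℓ = suc-injective (suc-injective (trans e (length-wrap a xs b)))
mirrorDistinct-wrap⁺ {a = a} {b} {xs} a≢b md (suc i) (suc j) e (s≤s i<j) eq =
  md i j e′ i<j (trans (sym (‼-∷ʳ-< xs i<ℓ)) (trans eq (‼-∷ʳ-< xs j<ℓ)))
  where
  e′ : suc (i + j) ≡ length xs
  e′ = trans (sym (+-suc i j)) (suc-injective (suc-injective (trans e (length-wrap a xs b))))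
  i<ℓ : i < length xs
  i<ℓ = mirror-bounds e′ .proj₁
  j<ℓ : j < length xs
  j<ℓ = mirror-bounds e′ .proj₂

mirrorDistinct-wrap⁻ : {a b : A} {xs : List A} →
  MirrorDistinct (a ∷ (xs ∷ʳ b)) → a ≢ b × MirrorDistinct xs
mirrorDistinct-wrap⁻ {a = a} {b} {xs} md = a≢b , md′
  where
  a≢b : a ≢ b
  a≢b a≡b = md 0 (suc (length xs)) (sym (length-wrap a xs b)) z<s
    (trans (cong just a≡b) (sym (‼-∷ʳ-length xs b)))
  md′ : MirrorDistinct xs
  md′ i j e i<j eq = md (suc i) (suc j) e′ (s≤s i<j)
    (trans (‼-∷ʳ-< xs (mirror-bounds e .proj₁))
           (trans eq (sym (‼-∷ʳ-< xs (mirror-bounds e .proj₂)))))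
    where
    e′ : suc (suc i + suc j) ≡ length (a ∷ (xs ∷ʳ b))
    e′ = trans (cong (suc ∘ suc) (trans (+-suc i j) e)) (sym (length-wrap a xs b))

-- A composition read from the outside in, each part p stored as p ∸ 1.
data Nested : ℕ → Set where
  empty  : Nested 0
  centre : ℕ → Nested 1
  layer  : ℕ → Nested k → ℕ → Nested (2 + k)

weight : Nested k → ℕ
weight empty         = 0
weight (centre m)    = suc m
weight (layer a t b) = 2 + a + (b + weight t)

AntiPalindromicᴺ : Nested k → Set
AntiPalindromicᴺ empty         = ⊤
AntiPalindromicᴺ (centre _)    = ⊤
AntiPalindromicᴺ (layer a t b) = a ≢ b × AntiPalindromicᴺ t

APNested : ℕ → Nested k → Set
APNested n t = AntiPalindromicᴺ t × weight t ≡ n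

-- (c , t) stands for the two nestings hookˡ and hookʳ below, with outer parts 1 and c + 2.
Hook : ℕ → ℕ × Nested k → Set
Hook n (c , t) = AntiPalindromicᴺ t × suc c + weight t ≡ n

widen : Nested (2 + k) → Nested (2 + k)
widen (layer a t b) = layer (suc a) t (suc b)

hook₀ : Nested k → ℕ × Nested k
hook₀ t = 0 , t

hookˡ hookʳ : ℕ × Nested k → Nested (2 + k)
hookˡ (c , t) = layer 0 t (suc c)
hookʳ (c , t) = layer (suc c) t 0

apNested : (n k : ℕ) → List (Nested k)
hooks : (n k : ℕ) → List (ℕ × Nested k)

apNested zero          zero          = empty ∷ []
apNested (suc n)       zero          = []
apNested zero          1             = []
apNested (suc n)       1             = centre n ∷ []
apNested zero          (suc (suc k)) = []
apNested 1             (suc (suc k)) = []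
apNested (suc (suc n)) (suc (suc k)) =
  map widen (apNested n (2 + k)) ++ map hookˡ (hooks n k) ++ map hookʳ (hooks n k)

hooks zero    k = []
hooks (suc n) k = map (map₁ suc) (hooks n k) ++ map hook₀ (apNested n k)

count hookCount : ℕ → ℕ → ℕ
count     n k = length (apNested n k)
hookCount n k = length (hooks n k)

count-step : ∀ n k → count (2 + n) (2 + k) ≡ count n (2 + k) + (hookCount n k + hookCount n k)
count-step n k = begin
  length (map widen E ++ map hookˡ H ++ map hookʳ H)
    ≡⟨ length-++ (map widen E) ⟩
  length (map widen E) + length (map hookˡ H ++ map hookʳ H)
    ≡⟨ cong₂ _+_ (length-map widen E) (length-++ (map hookˡ H)) ⟩
  length E + (length (map hookˡ H) + length (map hookʳ H))
    ≡⟨ cong (λ z → length E + z) (cong₂ _+_ (length-map hookˡ H) (length-map hookʳ H)) ⟩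
  length E + (length H + length H) ∎
  where
  open ≡-Reasoning
  E : List (Nested (2 + k))
  E = apNested n (2 + k)
  H : List (ℕ × Nested k)
  H = hooks n k

hookCount-step : ∀ n k → hookCount (suc n) k ≡ hookCount n k + count n k
hookCount-step n k = trans (length-++ (map (map₁ suc) (hooks n k)))
  (cong₂ _+_ (length-map (map₁ suc) (hooks n k)) (length-map hook₀ (apNested n k)))

widen-sound : {t : Nested (2 + k)} → APNested n t → APNested (2 + n) (widen t)
widen-sound {t = layer a t b} ((a≢b , ap) , refl) =
  (a≢b ∘ suc-injective , ap) , cong (suc ∘ suc ∘ suc) (+-suc a (b + weight t))

hookˡ-sound : {p : ℕ × Nested k} → Hook n p → APNested (2 + n) (hookˡ p)
hookˡ-sound (ap , refl) = ((λ ()) , ap) , refl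

hookʳ-sound : {p : ℕ × Nested k} → Hook n p → APNested (2 + n) (hookʳ p)
hookʳ-sound (ap , refl) = ((λ ()) , ap) , refl

apNested-sound : ∀ n k → All (APNested n) (apNested n k)
hooks-sound : ∀ n k → All (Hook n) (hooks n k)

apNested-sound zero          zero          = (tt , refl) ∷ []
apNested-sound (suc n)       zero          = []
apNested-sound zero          1             = []
apNested-sound (suc n)       1             = (tt , refl) ∷ []
apNested-sound zero          (suc (suc k)) = []
apNested-sound 1             (suc (suc k)) = []
apNested-sound (suc (suc n)) (suc (suc k)) =
  All.++⁺ (All.map⁺ (All.map widen-sound (apNested-sound n (2 + k))))
    (All.++⁺ (All.map⁺ (All.map hookˡ-sound (hooks-sound n k)))
             (All.map⁺ (All.map hookʳ-sound (hooks-sound n k))))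

hooks-sound zero    k = []
hooks-sound (suc n) k =
  All.++⁺ (All.map⁺ (All.map (λ { (ap , refl) → ap , refl }) (hooks-sound n k)))
          (All.map⁺ (All.map (λ { (ap , refl) → ap , refl }) (apNested-sound n k)))

widen-∈ : ∀ {n k} {t : Nested (2 + k)} →
  t ∈ apNested n (2 + k) → widen t ∈ apNested (2 + n) (2 + k)
widen-∈ = ∈-++⁺ˡ ∘ ∈-map⁺ widen

hookˡ-∈ : ∀ {n k} {p : ℕ × Nested k} → p ∈ hooks n k → hookˡ p ∈ apNested (2 + n) (2 + k)
hookˡ-∈ {n = n} {k = k} =
  ∈-++⁺ʳ (map widen (apNested n (2 + k))) ∘ ∈-++⁺ˡ ∘ ∈-map⁺ hookˡ

hookʳ-∈ : ∀ {n k} {p : ℕ × Nested k} → p ∈ hooks n k → hookʳ p ∈ apNested (2 + n) (2 + k)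
hookʳ-∈ {n = n} {k = k} =
  ∈-++⁺ʳ (map widen (apNested n (2 + k))) ∘ ∈-++⁺ʳ (map hookˡ (hooks n k)) ∘ ∈-map⁺ hookʳ

apNested-complete : (t : Nested k) → APNested n t → t ∈ apNested n k
layer-complete : ∀ a b (t : Nested k) → a ≢ b → AntiPalindromicᴺ t →
  weight (layer a t b) ≡ n → layer a t b ∈ apNested n (2 + k)
hooks-complete : ∀ c (t : Nested k) → AntiPalindromicᴺ t → (c , t) ∈ hooks (suc c + weight t) k

apNested-complete empty         (_ , refl)          = here refl
apNested-complete (centre m)    (_ , refl)          = here refl
apNested-complete (layer a t b) ((a≢b , ap) , w≡n) = layer-complete a b t a≢b ap w≡n

layer-complete zero    zero    t a≢b ap w≡n  = ⊥-elim (a≢b refl)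
layer-complete zero    (suc c) t a≢b ap refl = hookˡ-∈ {suc c + weight t} (hooks-complete c t ap)
layer-complete (suc c) zero    t a≢b ap refl = hookʳ-∈ {suc c + weight t} (hooks-complete c t ap)
layer-complete (suc a) (suc b) t a≢b ap refl =
  widen-∈ {n = suc a + (suc b + weight t)}
    (layer-complete a b t (a≢b ∘ cong suc) ap (cong suc (sym (+-suc a (b + weight t)))))

hooks-complete zero    t ap =
  ∈-++⁺ʳ (map (map₁ suc) (hooks (weight t) _)) (∈-map⁺ hook₀ (apNested-complete t (ap , refl)))
hooks-complete (suc c) t ap = ∈-++⁺ˡ (∈-map⁺ (map₁ suc) (hooks-complete c t ap))

widen-injective : {s t : Nested (2 + k)} → widen s ≡ widen t → s ≡ t
widen-injective {s = layer _ _ _} {layer _ _ _} refl = refl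

hookˡ-injective : {p q : ℕ × Nested k} → hookˡ p ≡ hookˡ q → p ≡ q
hookˡ-injective {p = _ , _} {_ , _} refl = refl

hookʳ-injective : {p q : ℕ × Nested k} → hookʳ p ≡ hookʳ q → p ≡ q
hookʳ-injective {p = _ , _} {_ , _} refl = refl

apNested-unique : ∀ n k → Unique (apNested n k)
hooks-unique : ∀ n k → Unique (hooks n k)

apNested-unique zero          zero          = [] ∷ []
apNested-unique (suc n)       zero          = []
apNested-unique zero          1             = []
apNested-unique (suc n)       1             = [] ∷ []
apNested-unique zero          (suc (suc k)) = []
apNested-unique 1             (suc (suc k)) = []
apNested-unique (suc (suc n)) (suc (suc k)) =
  Unique.++⁺ (Unique.map⁺ widen-injective (apNested-unique n (2 + k)))
    (Unique.++⁺ (Unique.map⁺ hookˡ-injective (hooks-unique n k))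
                (Unique.map⁺ hookʳ-injective (hooks-unique n k))
                (map-disjoint λ { (_ , _) (_ , _) () }))
    (disjoint-++⁺ʳ {ys = map hookˡ (hooks n k)} {zs = map hookʳ (hooks n k)}
                   (map-disjoint λ { (layer _ _ _) (_ , _) () })
                   (map-disjoint λ { (layer _ _ _) (_ , _) () }))

hooks-unique zero    k = []
hooks-unique (suc n) k =
  Unique.++⁺ (Unique.map⁺ (λ { {_ , _} {_ , _} refl → refl }) (hooks-unique n k))
             (Unique.map⁺ (λ { refl → refl }) (apNested-unique n k))
             (map-disjoint λ { (_ , _) _ () })

flatten : Nested k → List ℕ
flatten empty         = []
flatten (centre m)    = suc m ∷ []
flatten (layer a t b) = suc a ∷ (flatten t ∷ʳ suc b)

length-flatten : (t : Nested k) → length (flatten t) ≡ k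
length-flatten empty         = refl
length-flatten (centre m)    = refl
length-flatten (layer a t b) =
  trans (length-wrap (suc a) (flatten t) (suc b)) (cong (suc ∘ suc) (length-flatten t))

sum-flatten : (t : Nested k) → sum (flatten t) ≡ weight t
sum-flatten empty         = refl
sum-flatten (centre m)    = +-identityʳ (suc m)
sum-flatten (layer a t b) = begin
  suc a + sum (flatten t ∷ʳ suc b)   ≡⟨ cong (λ z → suc a + z) (sum-++ (flatten t) (suc b ∷ [])) ⟩
  suc a + (sum (flatten t) + (suc b + 0)) ≡⟨ cong (λ z → suc a + (z + (suc b + 0))) (sum-flatten t) ⟩
  suc a + (weight t + (suc b + 0))   ≡⟨ cong (λ z → suc a + (weight t + z)) (+-identityʳ (suc b)) ⟩
  suc a + (weight t + suc b)         ≡⟨ cong (λ z → suc a + z) (+-comm (weight t) (suc b)) ⟩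
  suc a + (suc b + weight t)         ≡⟨ cong suc (+-suc a (b + weight t)) ⟩
  2 + a + (b + weight t)             ∎
  where open ≡-Reasoning

flatten-positive : (t : Nested k) → All (0 <_) (flatten t)
flatten-positive empty         = []
flatten-positive (centre m)    = z<s ∷ []
flatten-positive (layer a t b) = z<s ∷ All.∷ʳ⁺ (flatten-positive t) z<s

flatten-injective : {s t : Nested k} → flatten s ≡ flatten t → s ≡ t
flatten-injective {s = empty}    {empty}    _    = refl
flatten-injective {s = centre _} {centre _} refl = refl
flatten-injective {s = layer a s b} {layer _ t _} eq with ∷-injective eq
... | refl , eq′ with ∷ʳ-injective (flatten s) (flatten t) eq′
... | s≡t , refl = cong (λ u → layer a u b) (flatten-injective s≡t)

flatten-surjective : ∀ k (σ : List ℕ) → length σ ≡ k → All (0 <_) σ →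
  ∃ λ (t : Nested k) → flatten t ≡ σ
flatten-surjective zero []            _ _ = empty , refl
flatten-surjective 1    (zero ∷ [])   _ (() ∷ [])
flatten-surjective 1    (suc m ∷ [])  _ _ = centre m , refl
flatten-surjective (suc (suc k)) (suc a ∷ τ) ℓ≡ (_ ∷ τ-pos) with initLast τ
... | σ ∷ʳ′ zero    with () ← All.∷ʳ⁻ τ-pos .proj₂
... | σ ∷ʳ′ (suc b)
  with flatten-surjective k σ (suc-injective (trans (sym (length-∷ʳ σ (suc b))) (suc-injective ℓ≡)))
                              (All.∷ʳ⁻ τ-pos .proj₁)
... | t , refl = layer a t b , refl

antiPalindromicᴺ⇔mirrorDistinct : (t : Nested k) →
  AntiPalindromicᴺ t ⇔ MirrorDistinct (flatten t)
antiPalindromicᴺ⇔mirrorDistinct empty         = mk⇔ (λ _ _ _ ()) (λ _ → tt)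
antiPalindromicᴺ⇔mirrorDistinct (centre m)    = mk⇔ singleton (λ _ → tt)
  where
  singleton : ⊤ → MirrorDistinct (suc m ∷ [])
  singleton _ i zero    e ()
  singleton _ i (suc j) e _ with () ← m+n≡0⇒n≡0 i (suc-injective e)
antiPalindromicᴺ⇔mirrorDistinct (layer a t b) = mk⇔
  (λ (a≢b , ap) → mirrorDistinct-wrap⁺ (a≢b ∘ suc-injective) (to (antiPalindromicᴺ⇔mirrorDistinct t) ap))
  (λ md → let (1+a≢1+b , md′) = mirrorDistinct-wrap⁻ md in
          1+a≢1+b ∘ cong suc , from (antiPalindromicᴺ⇔mirrorDistinct t) md′)

∈-flatten-apNested⇔APComp : ∀ n k (σ : List ℕ) → σ ∈ map flatten (apNested n k) ⇔ APComp n k σ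
∈-flatten-apNested⇔APComp n k σ = mk⇔ sound complete
  where
  sound : σ ∈ map flatten (apNested n k) → APComp n k σ
  sound σ∈ with ∈-map⁻ flatten σ∈
  ... | t , t∈ , refl with All.lookup (apNested-sound n k) t∈
  ... | ap , refl =
    (flatten-positive t , sum-flatten t) , length-flatten t ,
    from (antiPalindromic⇔mirrorDistinct (flatten t)) (to (antiPalindromicᴺ⇔mirrorDistinct t) ap)

  complete : APComp n k σ → σ ∈ map flatten (apNested n k)
  complete ((σ-pos , σ-sum) , σ-length , σ-ap) with flatten-surjective k σ σ-length σ-pos
  ... | t , refl = ∈-map⁺ flatten (apNested-complete t (ap , trans (sym (sum-flatten t)) σ-sum))
    where
    ap : AntiPalindromicᴺ t
    ap = from (antiPalindromicᴺ⇔mirrorDistinct t) (to (antiPalindromic⇔mirrorDistinct (flatten t)) σ-ap)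

isAPCount⇒≡count : ∀ {n k c} → IsAPCount n k c → c ≡ count n k
isAPCount⇒≡count {n} {k} (L , L! , L⇔ , refl) = begin
  length L
    ≡⟨ unique∧set⇒length≡ L! (Unique.map⁺ flatten-injective (apNested-unique n k)) L⇔L′ ⟩
  length (map flatten (apNested n k))
    ≡⟨ length-map flatten (apNested n k) ⟩
  count n k ∎
  where
  open ≡-Reasoning
  L⇔L′ : ∀ σ → σ ∈ L ⇔ σ ∈ map flatten (apNested n k)
  L⇔L′ σ = ⇔-trans (L⇔ σ) (⇔-sym (∈-flatten-apNested⇔APComp n k σ))

counts : Series
counts n k = + count n k

denominatorMonomials : List Monomial
denominatorMonomials =
  (+ 1 , 0 , 0) ∷ (- + 1 , 1 , 0) ∷ (- + 1 , 2 , 0) ∷ (+ 1 , 3 , 0) ∷ (- + 2 , 3 , 2) ∷ []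

annihilated : ∀ n k → (denominatorMonomials ·ₚ counts) (3 + n) (2 + k) ≡ + 0
annihilated n k =
  denominator-annihilates (λ m → count m (2 + k)) (λ m → count m k) (λ m → hookCount m k)
    (λ m → count-step m k) (λ m → hookCount-step m k) n

denominatorMonomials·counts : ∀ n k → (denominatorMonomials ·ₚ counts) n k ≡ numerator n k
denominatorMonomials·counts 0                     0             = refl
denominatorMonomials·counts 1                     0             = refl
denominatorMonomials·counts 2                     0             = refl
denominatorMonomials·counts 3                     0             = refl
denominatorMonomials·counts (suc (suc (suc (suc n)))) 0         = refl
denominatorMonomials·counts 0                     1             = refl
denominatorMonomials·counts 1                     1             = refl
denominatorMonomials·counts 2                     1             = refl
denominatorMonomials·counts 3                     1             = refl
denominatorMonomials·counts (suc (suc (suc (suc n)))) 1         = refl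
denominatorMonomials·counts 0                     (suc (suc k)) = refl
denominatorMonomials·counts 1                     (suc (suc k)) = refl
denominatorMonomials·counts 2                     (suc (suc k)) = refl
-- n = 3 is split off: in a clause for 3 + n the test 3 ≟ 3 + n in numerator would not reduce.
denominatorMonomials·counts 3                     (suc (suc k)) = annihilated 0 k
denominatorMonomials·counts (suc (suc (suc (suc n)))) (suc (suc k)) = annihilated (suc n) k

theorem2p8 : (a : ℕ → ℕ → ℕ) → (∀ n k → IsAPCount n k (a n k)) →
    ∀ n k → (denominator ⊛ (λ n k → + a n k)) n k ≡ numerator n k
theorem2p8 a isCount n k = begin
  (denominator ⊛ (λ n k → + a n k)) n k
    ≡⟨ ⊛-congʳ denominator (λ n k → cong +_ (isAPCount⇒≡count (isCount n k))) n k ⟩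
  (denominator ⊛ counts) n k
    ≡⟨ poly-⊛ denominatorMonomials counts n k ⟩
  (denominatorMonomials ·ₚ counts) n k
    ≡⟨ denominatorMonomials·counts n k ⟩
  numerator n k ∎
  where open ≡-Reasoning
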